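{- Let $\Sigma$ be an alphabet containing at least three distinct symbols $\mathtt{a},\mathtt{b},\mathtt{c}$, and let $\mathit{op}$ be either the insertion operation or the replacement operation. Then for every integer $n \ge 13$, $\mathit{MS}_{\mathit{op}}(\gamma, n) \ge 5/2$.
   Context: For a string $T$ of length $n$ and $1\le i\le j\le n$, $T[i..j] = T[i]\cdots T[j]$. A set $\Gamma\subseteq[1,n]$ is a string attractor of $T$ if for every non-empty substring $P$ of $T$ there exist $i$ with $T[i..i+|P|-1]=P$ and some $k\in\Gamma$ with $i\le k\le i+|P|-1$. $\gamma(T)$ denotes the minimum size of a string attractor of $T$. For $\mathit{op}$ the insertion (resp. replacement) operation, $\mathit{ed}_{\mathit{op}}(T,T')=1$ means that $T'$ is obtained from $T$ by inserting one character of $\Sigma$ at some position (resp. replacing one character of $T$ by a different character of $\Sigma$). The multiplicative sensitivity is $\mathit{MS}_{\mathit{op}}(\gamma,n) = \max_{T\in\Sigma^n,\,T'\in\Sigma^*}\{\gamma(T')/\gamma(T) \mid \mathit{ed}_{\mathit{op}}(T,T')=1\}$. -}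

module Defs where

open import Data.Nat using (ℕ; zero; suc; _+_; _*_; _≤_; _<_)
open import Data.List using (List; []; _∷_; _++_; length; take; drop; lookup)
open import Data.List.Relation.Unary.All using (All)
open import Data.List.Relation.Unary.Unique.Propositional using (Unique)
open import Data.List.Membership.Propositional using (_∈_)
open import Data.Product using (Σ; ∃; ∃-syntax; _×_; _,_)
open import Relation.Binary.PropositionalEquality using (_≡_; _≢_)

-- Strings over an alphabet A are lists; positions are 0-based
-- (position k here corresponds to position k+1 in the paper).

module _ {A : Set} where

  OccursAt : List A → List A → ℕ → Set
  OccursAt T P i = (i + length P ≤ length T) × (take (length P) (drop i T) ≡ P)

  IsSubstring : List A → List A → Set
  IsSubstring T P = ∃[ i ] OccursAt T P i

  IsAttractor : List A → List ℕ → Set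
  IsAttractor T Γ =
    All (λ k → k < length T) Γ ×
    (∀ (P : List A) → P ≢ [] → IsSubstring T P →
       ∃[ i ] (OccursAt T P i × ∃[ k ] (k ∈ Γ × i ≤ k × k < i + length P)))

  -- γ(T) = g : g is the minimum size of a string attractor of T
  -- (attractors are duplicate-free lists, so their length is the set size).
  IsGamma : List A → ℕ → Set
  IsGamma T g =
    (∃[ Γ ] (Unique Γ × IsAttractor T Γ × length Γ ≡ g)) ×
    (∀ (Γ : List ℕ) → Unique Γ → IsAttractor T Γ → g ≤ length Γ)

data Op : Set where
  ins rep : Op

EdOne : {A : Set} → Op → List A → List A → Set
EdOne {A} ins T T' =
  ∃[ i ] Σ (i ≤ length T) λ _ → ∃[ x ] (T' ≡ take i T ++ (x ∷ drop i T))
EdOne {A} rep T T' =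
  ∃[ i ] Σ (i < length T) λ i<n → ∃[ x ] (x ≢ lookup T (Data.Fin.fromℕ< i<n) ×
     (T' ≡ take i T ++ (x ∷ drop (suc i) T)))
  where import Data.Fin

-- MS_op(γ, n) ≥ p / q, i.e. the maximum of γ(T')/γ(T) over T ∈ Σ^n and
-- T' with ed_op(T,T') = 1 is at least p/q: some such pair attains a ratio
-- ≥ p/q (q · γ(T') ≥ p · γ(T)).
MSAtLeast : (A : Set) → Op → ℕ → ℕ → ℕ → Set
MSAtLeast A op n p q =
  ∃[ T ] (length {A = A} T ≡ n × ∃[ T' ] (EdOne op T T' ×
    ∃[ g ] ∃[ g' ] (IsGamma T g × IsGamma T' g' × p * g ≤ q * g')))

-- Let T = a b³ a³ b^(n-7).  Inserting c after the prefix a b³ a³ b, or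
-- replacing the b that follows this prefix by c, gives T' = a b³ a³ b c b^r.
-- The positions {4, 7}, where the blocks a³ and b^(n-7) begin, form an
-- attractor of T (checked window by window), and T has two distinct
-- letters, so γ(T) = 2.  In T' the factors abb, ba, aab, c and bbbb only
-- occur starting at 0, 3, 5, 8 and ≥ 9 respectively, so the positions
-- hitting them lie in the disjoint ranges [0,3), [3,5), [5,8), {8} and
-- [9,∞); hence γ(T') ≥ 5, and {0,3,5,8,9} is an attractor.  As γ is
-- invariant under injective renaming of letters, a, b, c may be any three
-- distinct symbols.
module Submission where

open import Defs
open import Data.Nat using (ℕ; suc; _+_; _≤_; _<_; _≤?_; z≤n; s≤s)
open import Data.Nat.Properties
  using (≤-refl; ≤-trans; ≤-antisym; <-trans; <-≤-trans; <⇒≢; +-comm; +-cancelˡ-≤;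
         +-monoˡ-≤; m≤m+n; m≤n+m; m≤n⇒m≤1+n; m<1+n⇒m≤n; m≤n⇒∃[o]m+o≡n; _≟_)
open import Data.List using (List; []; _∷_; length; take; drop; map; replicate)
open import Data.List.Properties
  using (∷-injectiveˡ; take-map; drop-map; map-injective; length-map; length-replicate)
open import Data.List.Relation.Unary.All using (All; []; _∷_)
import Data.List.Relation.Unary.All as All
open import Data.List.Relation.Unary.All.Properties using (take⁺; drop⁺; replicate⁺)
open import Data.List.Relation.Unary.AllPairs using ([]; _∷_)
import Data.List.Relation.Unary.AllPairs as AllPairs
open import Data.List.Relation.Unary.Linked using (Linked; [-]; _∷_)
open import Data.List.Relation.Unary.Linked.Properties using (Linked⇒AllPairs)
open import Data.List.Relation.Unary.Unique.Propositional using (Unique)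
open import Data.List.Relation.Unary.Any using (here; there)
open import Data.List.Membership.Propositional using (_∈_)
open import Data.List.Membership.DecPropositional _≟_ using (_∈?_)
open import Data.List.Relation.Binary.Subset.Propositional using (_⊆_)
open import Data.Product using (∃-syntax; _×_; _,_; proj₂)
open import Data.Empty using (⊥-elim)
open import Function using (Injective)
open import Relation.Nullary.Decidable using (True; toWitness)
open import Relation.Binary.PropositionalEquality using (_≡_; _≢_; refl; sym; trans; cong; subst; subst₂)

decide-≤ : ∀ {m n} {m≤n : True (m ≤? n)} → m ≤ n
decide-≤ {m≤n = m≤n} = toWitness m≤n

decide-∈ : ∀ {x xs} {x∈xs : True (x ∈? xs)} → x ∈ xs
decide-∈ {x∈xs = x∈xs} = toWitness x∈xs

increasing⇒Unique : ∀ {ks : List ℕ} → Linked _<_ ks → Unique ks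
increasing⇒Unique ks↑ = AllPairs.map <⇒≢ (Linked⇒AllPairs <-trans ks↑)

decide-≤-13+ : ∀ {n r} {n≤13 : True (n ≤? 13)} → n ≤ 13 + r
decide-≤-13+ {r = r} {n≤13} = ≤-trans (toWitness n≤13) (m≤m+n 13 r)

≤∧<+1⇒≡ : ∀ {i k} → i ≤ k → k < i + 1 → k ≡ i
≤∧<+1⇒≡ {i} {k} i≤k k<i+1 = ≤-antisym (m<1+n⇒m≤n (subst (k <_) (+-comm i 1) k<i+1)) i≤k

module _ {A : Set} where

  take-drop-replicate : ∀ (x : A) j l r → j + l ≤ r → take l (drop j (replicate r x)) ≡ replicate l x
  take-drop-replicate x 0       0       r       _           = refl
  take-drop-replicate x 0       (suc l) (suc r) (s≤s j+l≤r) = cong (x ∷_) (take-drop-replicate x 0 l r j+l≤r)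
  take-drop-replicate x (suc j) l       (suc r) (s≤s j+l≤r) = take-drop-replicate x j l r j+l≤r

  ∈-remove : ∀ {x : A} xs → x ∈ xs →
    ∃[ xs′ ] (length xs ≡ suc (length xs′) × (∀ {y} → y ∈ xs → y ≢ x → y ∈ xs′))
  ∈-remove (x ∷ xs) (here refl) =
    xs , refl , λ { (here refl) y≢x → ⊥-elim (y≢x refl) ; (there y∈xs) _ → y∈xs }
  ∈-remove (z ∷ xs) (there x∈xs) with xs′ , eq , keep ← ∈-remove xs x∈xs =
    z ∷ xs′ , cong suc eq , λ { (here refl) _ → here refl ; (there y∈xs) y≢x → there (keep y∈xs y≢x) }

  Unique-⊆⇒length-≤ : ∀ {ys xs : List A} → Unique ys → ys ⊆ xs → length ys ≤ length xs
  Unique-⊆⇒length-≤ {[]}     _                ys⊆xs = z≤n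
  Unique-⊆⇒length-≤ {y ∷ ys} {xs} (y∉ys ∷ ys!) ys⊆xs
    with xs′ , eq , keep ← ∈-remove xs (ys⊆xs (here refl)) =
    subst (suc (length ys) ≤_) (sym eq)
      (s≤s (Unique-⊆⇒length-≤ ys! λ z∈ys →
        keep (ys⊆xs (there z∈ys)) λ z≡y → All.lookup y∉ys z∈ys (sym z≡y)))

module _ {A : Set} where

  OccursThrough : List A → List ℕ → List A → Set
  OccursThrough T Γ P = ∃[ i ] (OccursAt T P i × ∃[ k ] (k ∈ Γ × i ≤ k × k < i + length P))

  Covers : List ℕ → List A → Set
  Covers Γ T = ∀ i l → i + suc l ≤ length T →
    ∃[ i′ ] (i′ + suc l ≤ length T × take (suc l) (drop i′ T) ≡ take (suc l) (drop i T) ×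
             ∃[ k ] (k ∈ Γ × i′ ≤ k × k < i′ + suc l))

  Covers⇒IsAttractor : ∀ {T : List A} {Γ} → All (_< length T) Γ → Covers Γ T → IsAttractor T Γ
  Covers⇒IsAttractor {T} {Γ} Γ<|T| covers = Γ<|T| , attracts
    where
    attracts : ∀ P → P ≢ [] → IsSubstring T P → OccursThrough T Γ P
    attracts []       P≢[] _ = ⊥-elim (P≢[] refl)
    attracts (p ∷ ps) _    (i , bound , window≡P)
      with i′ , bound′ , window′≡window , hit ← covers i (length ps) bound =
      i′ , (bound′ , trans window′≡window window≡P) , hit

  IsAttractor⇒letter-hit : ∀ {T : List A} {Γ x} → IsAttractor T Γ → IsSubstring T (x ∷ []) →
    ∃[ k ] (k ∈ Γ × take 1 (drop k T) ≡ x ∷ [])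
  IsAttractor⇒letter-hit {x = x} (_ , attracts) x-occurs
    with i , (_ , window≡x) , k , k∈Γ , i≤k , k<i+1 ← attracts (x ∷ []) (λ ()) x-occurs
    with refl ← ≤∧<+1⇒≡ i≤k k<i+1 = k , k∈Γ , window≡x

  two-letters⇒2≤|attractor| : ∀ {T : List A} {Γ x y} → x ≢ y → IsAttractor T Γ →
    IsSubstring T (x ∷ []) → IsSubstring T (y ∷ []) → 2 ≤ length Γ
  two-letters⇒2≤|attractor| x≢y attr x-occurs y-occurs
    with kx , kx∈Γ , at-kx ← IsAttractor⇒letter-hit attr x-occurs
       | ky , ky∈Γ , at-ky ← IsAttractor⇒letter-hit attr y-occurs =
    Unique-⊆⇒length-≤ ((kx≢ky ∷ []) ∷ [] ∷ []) (All.lookup (kx∈Γ ∷ ky∈Γ ∷ []))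
    where
    kx≢ky : kx ≢ ky
    kx≢ky refl = x≢y (∷-injectiveˡ (trans (sym at-kx) at-ky))

module _ {A B : Set} (f : A → B) where

  take-drop-map : ∀ l i T → take l (drop i (map f T)) ≡ map f (take l (drop i T))
  take-drop-map l i T = trans (cong (take l) (drop-map i T)) (take-map l (drop i T))

  OccursAt-map⁺ : ∀ {T P i} → OccursAt T P i → OccursAt (map f T) (map f P) i
  OccursAt-map⁺ {T} {P} {i} (bound , window≡P) =
    subst₂ (λ |P| |T| → i + |P| ≤ |T|) (sym (length-map f P)) (sym (length-map f T)) bound ,
    subst (λ |P| → take |P| (drop i (map f T)) ≡ map f P) (sym (length-map f P))
      (trans (take-drop-map (length P) i T) (cong (map f) window≡P))

  OccursThrough-map⁺ : ∀ {T Γ P} → OccursThrough T Γ P → OccursThrough (map f T) Γ (map f P)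
  OccursThrough-map⁺ {P = P} (i , occ , k , k∈Γ , i≤k , k<i+|P|) =
    i , OccursAt-map⁺ occ , k , k∈Γ , i≤k , subst (λ |P| → k < i + |P|) (sym (length-map f P)) k<i+|P|

  IsAttractor-map⁺ : ∀ {T Γ} → IsAttractor T Γ → IsAttractor (map f T) Γ
  IsAttractor-map⁺ {T} {Γ} (Γ<|T| , attracts) =
    All.map (subst (_ <_) (sym (length-map f T))) Γ<|T| , attracts′
    where
    attracts′ : ∀ P → P ≢ [] → IsSubstring (map f T) P → OccursThrough (map f T) Γ P
    attracts′ P P≢[] (i₀ , bound , window≡P) =
      subst (OccursThrough (map f T) Γ) fQ≡P (OccursThrough-map⁺ (attracts Q Q≢[] Q-occurs))
      where
      Q : List A
      Q = take (length P) (drop i₀ T)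
      fQ≡P : map f Q ≡ P
      fQ≡P = trans (sym (take-drop-map (length P) i₀ T)) window≡P
      |Q|≡|P| : length Q ≡ length P
      |Q|≡|P| = trans (sym (length-map f Q)) (cong length fQ≡P)
      Q≢[] : Q ≢ []
      Q≢[] Q≡[] = P≢[] (trans (sym fQ≡P) (cong (map f) Q≡[]))
      Q-occurs : IsSubstring T Q
      Q-occurs = i₀ , subst₂ (λ |Q| |T| → i₀ + |Q| ≤ |T|) (sym |Q|≡|P|) (length-map f T) bound ,
                 subst (λ |Q| → take |Q| (drop i₀ T) ≡ Q) (sym |Q|≡|P|) refl

  module _ (f-inj : Injective _≡_ _≡_ f) where

    OccursAt-map⁻ : ∀ {T P i} → OccursAt (map f T) (map f P) i → OccursAt T P i
    OccursAt-map⁻ {T} {P} {i} (bound , window≡fP) =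
      subst₂ (λ |P| |T| → i + |P| ≤ |T|) (length-map f P) (length-map f T) bound ,
      map-injective f-inj
        (trans (sym (take-drop-map (length P) i T))
               (subst (λ |P| → take |P| (drop i (map f T)) ≡ map f P) (length-map f P) window≡fP))

    OccursThrough-map⁻ : ∀ {T Γ P} → OccursThrough (map f T) Γ (map f P) → OccursThrough T Γ P
    OccursThrough-map⁻ {P = P} (i , occ , k , k∈Γ , i≤k , k<i+|fP|) =
      i , OccursAt-map⁻ occ , k , k∈Γ , i≤k , subst (λ |P| → k < i + |P|) (length-map f P) k<i+|fP|

    IsAttractor-map⁻ : ∀ {T Γ} → IsAttractor (map f T) Γ → IsAttractor T Γ
    IsAttractor-map⁻ {T} {Γ} (Γ<|fT| , attracts) =
      All.map (subst (_ <_) (length-map f T)) Γ<|fT| , attracts′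
      where
      attracts′ : ∀ P → P ≢ [] → IsSubstring T P → OccursThrough T Γ P
      attracts′ P P≢[] (i₀ , occ₀) =
        OccursThrough-map⁻
          (attracts (map f P) (λ fP≡[] → P≢[] (map-injective f-inj fP≡[])) (i₀ , OccursAt-map⁺ occ₀))

    IsGamma-map : ∀ {T g} → IsGamma T g → IsGamma (map f T) g
    IsGamma-map ((Γ , Γ! , attr , |Γ|≡g) , minimal) =
      (Γ , Γ! , IsAttractor-map⁺ attr , |Γ|≡g) , λ Γ′ Γ′! attr′ → minimal Γ′ Γ′! (IsAttractor-map⁻ attr′)

data Letter : Set where
  𝚊 𝚋 𝚌 : Letter

𝚋-window : ∀ j l r → All (_≡ 𝚋) (take l (drop j (replicate r 𝚋)))
𝚋-window j l r = take⁺ l (drop⁺ j (replicate⁺ r refl))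

source : ℕ → List Letter
source k = 𝚊 ∷ 𝚋 ∷ 𝚋 ∷ 𝚋 ∷ 𝚊 ∷ 𝚊 ∷ 𝚊 ∷ replicate (6 + k) 𝚋

edited : ℕ → List Letter
edited m = 𝚊 ∷ 𝚋 ∷ 𝚋 ∷ 𝚋 ∷ 𝚊 ∷ 𝚊 ∷ 𝚊 ∷ 𝚋 ∷ 𝚌 ∷ replicate (4 + m) 𝚋

length-source : ∀ k → length (source k) ≡ 13 + k
length-source k = cong (13 +_) (length-replicate k)

length-edited : ∀ m → length (edited m) ≡ 13 + m
length-edited m = cong (13 +_) (length-replicate m)

source-covered : ∀ k → Covers (4 ∷ 7 ∷ []) (source k)
source-covered k 0 0 _ = 4 , decide-≤-13+ , refl , 4 , decide-∈ , ≤-refl , decide-≤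
source-covered k 0 1 _ = 6 , decide-≤-13+ , refl , 7 , decide-∈ , decide-≤ , decide-≤
source-covered k 0 2 _ = 6 , decide-≤-13+ , refl , 7 , decide-∈ , decide-≤ , decide-≤
source-covered k 0 3 _ = 6 , decide-≤-13+ , refl , 7 , decide-∈ , decide-≤ , decide-≤
source-covered k 0 (suc (suc (suc (suc l)))) bound = 0 , bound , refl , 4 , decide-∈ , z≤n , m≤m+n 5 l
source-covered k 1 0 _ = 7 , decide-≤-13+ , refl , 7 , decide-∈ , ≤-refl , decide-≤
source-covered k 1 1 _ = 7 , decide-≤-13+ , refl , 7 , decide-∈ , ≤-refl , decide-≤
source-covered k 1 2 _ = 7 , decide-≤-13+ , refl , 7 , decide-∈ , ≤-refl , decide-≤
source-covered k 1 (suc (suc (suc l))) bound = 1 , bound , refl , 4 , decide-∈ , decide-≤ , m≤m+n 5 l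
source-covered k 2 0 _ = 7 , decide-≤-13+ , refl , 7 , decide-∈ , ≤-refl , decide-≤
source-covered k 2 1 _ = 7 , decide-≤-13+ , refl , 7 , decide-∈ , ≤-refl , decide-≤
source-covered k 2 (suc (suc l)) bound = 2 , bound , refl , 4 , decide-∈ , decide-≤ , m≤m+n 5 l
source-covered k 3 0 _ = 7 , decide-≤-13+ , refl , 7 , decide-∈ , ≤-refl , decide-≤
source-covered k 3 (suc l) bound = 3 , bound , refl , 4 , decide-∈ , decide-≤ , m≤m+n 5 l
source-covered k 4 l bound = 4 , bound , refl , 4 , decide-∈ , ≤-refl , m≤m+n 5 l
source-covered k 5 0 _ = 4 , decide-≤-13+ , refl , 4 , decide-∈ , ≤-refl , decide-≤
source-covered k 5 1 _ = 4 , decide-≤-13+ , refl , 4 , decide-∈ , ≤-refl , decide-≤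
source-covered k 5 (suc (suc l)) bound = 5 , bound , refl , 7 , decide-∈ , decide-≤ , m≤m+n 8 l
source-covered k 6 0 _ = 4 , decide-≤-13+ , refl , 4 , decide-∈ , ≤-refl , decide-≤
source-covered k 6 (suc l) bound = 6 , bound , refl , 7 , decide-∈ , decide-≤ , m≤m+n 8 l
source-covered k 7 l bound = 7 , bound , refl , 7 , decide-∈ , ≤-refl , m≤m+n 8 l
source-covered k i@(suc (suc (suc (suc (suc (suc (suc (suc j)))))))) l bound =
  7 , ≤-trans (+-monoˡ-≤ (suc l) (m≤m+n 7 (suc j))) bound ,
  trans (take-drop-replicate 𝚋 0 (suc l) (6 + k) (≤-trans (m≤n+m (suc l) j) (m≤n⇒m≤1+n fits)))
        (sym (take-drop-replicate 𝚋 j (suc l) (5 + k) fits)) ,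
  7 , decide-∈ , ≤-refl , m≤m+n 8 l
  where
  fits : j + suc l ≤ 5 + k
  fits = +-cancelˡ-≤ 8 _ _ (subst (i + suc l ≤_) (length-source k) bound)

edited-covered : ∀ m → Covers (0 ∷ 3 ∷ 5 ∷ 8 ∷ 9 ∷ []) (edited m)
edited-covered m 0 l bound = 0 , bound , refl , 0 , decide-∈ , ≤-refl , s≤s z≤n
edited-covered m 1 0 _ = 3 , decide-≤-13+ , refl , 3 , decide-∈ , ≤-refl , decide-≤
edited-covered m 1 1 _ = 2 , decide-≤-13+ , refl , 3 , decide-∈ , decide-≤ , decide-≤
edited-covered m 1 (suc (suc l)) bound = 1 , bound , refl , 3 , decide-∈ , decide-≤ , m≤m+n 4 l
edited-covered m 2 0 _ = 3 , decide-≤-13+ , refl , 3 , decide-∈ , ≤-refl , decide-≤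
edited-covered m 2 (suc l) bound = 2 , bound , refl , 3 , decide-∈ , decide-≤ , m≤m+n 4 l
edited-covered m 3 l bound = 3 , bound , refl , 3 , decide-∈ , ≤-refl , m≤m+n 4 l
edited-covered m 4 0 _ = 5 , decide-≤-13+ , refl , 5 , decide-∈ , ≤-refl , decide-≤
edited-covered m 4 (suc l) bound = 4 , bound , refl , 5 , decide-∈ , decide-≤ , m≤m+n 6 l
edited-covered m 5 l bound = 5 , bound , refl , 5 , decide-∈ , ≤-refl , m≤m+n 6 l
edited-covered m 6 0 _ = 5 , decide-≤-13+ , refl , 5 , decide-∈ , ≤-refl , decide-≤
edited-covered m 6 1 _ = 0 , decide-≤-13+ , refl , 0 , decide-∈ , ≤-refl , decide-≤
edited-covered m 6 (suc (suc l)) bound = 6 , bound , refl , 8 , decide-∈ , decide-≤ , m≤m+n 9 l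
edited-covered m 7 0 _ = 3 , decide-≤-13+ , refl , 3 , decide-∈ , ≤-refl , decide-≤
edited-covered m 7 (suc l) bound = 7 , bound , refl , 8 , decide-∈ , decide-≤ , m≤m+n 9 l
edited-covered m 8 l bound = 8 , bound , refl , 8 , decide-∈ , ≤-refl , m≤m+n 9 l
edited-covered m 9 l bound = 9 , bound , refl , 9 , decide-∈ , ≤-refl , m≤m+n 10 l
edited-covered m i@(suc (suc (suc (suc (suc (suc (suc (suc (suc (suc j)))))))))) l bound =
  9 , ≤-trans (+-monoˡ-≤ (suc l) (m≤m+n 9 (suc j))) bound ,
  trans (take-drop-replicate 𝚋 0 (suc l) (4 + m) (≤-trans (m≤n+m (suc l) j) (m≤n⇒m≤1+n fits)))
        (sym (take-drop-replicate 𝚋 j (suc l) (3 + m) fits)) ,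
  9 , decide-∈ , ≤-refl , m≤m+n 10 l
  where
  fits : j + suc l ≤ 3 + m
  fits = +-cancelˡ-≤ 10 _ _ (subst (i + suc l ≤_) (length-edited m) bound)

abb-occurs-only-at-0 : ∀ m i → OccursAt (edited m) (𝚊 ∷ 𝚋 ∷ 𝚋 ∷ []) i → i ≡ 0
abb-occurs-only-at-0 m 0 _ = refl
abb-occurs-only-at-0 m 1 (_ , ())
abb-occurs-only-at-0 m 2 (_ , ())
abb-occurs-only-at-0 m 3 (_ , ())
abb-occurs-only-at-0 m 4 (_ , ())
abb-occurs-only-at-0 m 5 (_ , ())
abb-occurs-only-at-0 m 6 (_ , ())
abb-occurs-only-at-0 m 7 (_ , ())
abb-occurs-only-at-0 m 8 (_ , ())
abb-occurs-only-at-0 m (suc (suc (suc (suc (suc (suc (suc (suc (suc j))))))))) (_ , window≡abb)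
  with () ∷ _ ← subst (All (_≡ 𝚋)) window≡abb (𝚋-window j 3 (4 + m))

ba-occurs-only-at-3 : ∀ m i → OccursAt (edited m) (𝚋 ∷ 𝚊 ∷ []) i → i ≡ 3
ba-occurs-only-at-3 m 0 (_ , ())
ba-occurs-only-at-3 m 1 (_ , ())
ba-occurs-only-at-3 m 2 (_ , ())
ba-occurs-only-at-3 m 3 _ = refl
ba-occurs-only-at-3 m 4 (_ , ())
ba-occurs-only-at-3 m 5 (_ , ())
ba-occurs-only-at-3 m 6 (_ , ())
ba-occurs-only-at-3 m 7 (_ , ())
ba-occurs-only-at-3 m 8 (_ , ())
ba-occurs-only-at-3 m (suc (suc (suc (suc (suc (suc (suc (suc (suc j))))))))) (_ , window≡ba)
  with _ ∷ () ∷ _ ← subst (All (_≡ 𝚋)) window≡ba (𝚋-window j 2 (4 + m))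

aab-occurs-only-at-5 : ∀ m i → OccursAt (edited m) (𝚊 ∷ 𝚊 ∷ 𝚋 ∷ []) i → i ≡ 5
aab-occurs-only-at-5 m 0 (_ , ())
aab-occurs-only-at-5 m 1 (_ , ())
aab-occurs-only-at-5 m 2 (_ , ())
aab-occurs-only-at-5 m 3 (_ , ())
aab-occurs-only-at-5 m 4 (_ , ())
aab-occurs-only-at-5 m 5 _ = refl
aab-occurs-only-at-5 m 6 (_ , ())
aab-occurs-only-at-5 m 7 (_ , ())
aab-occurs-only-at-5 m 8 (_ , ())
aab-occurs-only-at-5 m (suc (suc (suc (suc (suc (suc (suc (suc (suc j))))))))) (_ , window≡aab)
  with () ∷ _ ← subst (All (_≡ 𝚋)) window≡aab (𝚋-window j 3 (4 + m))

c-occurs-only-at-8 : ∀ m i → OccursAt (edited m) (𝚌 ∷ []) i → i ≡ 8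
c-occurs-only-at-8 m 0 (_ , ())
c-occurs-only-at-8 m 1 (_ , ())
c-occurs-only-at-8 m 2 (_ , ())
c-occurs-only-at-8 m 3 (_ , ())
c-occurs-only-at-8 m 4 (_ , ())
c-occurs-only-at-8 m 5 (_ , ())
c-occurs-only-at-8 m 6 (_ , ())
c-occurs-only-at-8 m 7 (_ , ())
c-occurs-only-at-8 m 8 _ = refl
c-occurs-only-at-8 m (suc (suc (suc (suc (suc (suc (suc (suc (suc j))))))))) (_ , window≡c)
  with () ∷ _ ← subst (All (_≡ 𝚋)) window≡c (𝚋-window j 1 (4 + m))

bbbb-occurs-only-from-9 : ∀ m i → OccursAt (edited m) (𝚋 ∷ 𝚋 ∷ 𝚋 ∷ 𝚋 ∷ []) i → 9 ≤ i
bbbb-occurs-only-from-9 m 0 (_ , ())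
bbbb-occurs-only-from-9 m 1 (_ , ())
bbbb-occurs-only-from-9 m 2 (_ , ())
bbbb-occurs-only-from-9 m 3 (_ , ())
bbbb-occurs-only-from-9 m 4 (_ , ())
bbbb-occurs-only-from-9 m 5 (_ , ())
bbbb-occurs-only-from-9 m 6 (_ , ())
bbbb-occurs-only-from-9 m 7 (_ , ())
bbbb-occurs-only-from-9 m 8 (_ , ())
bbbb-occurs-only-from-9 m (suc (suc (suc (suc (suc (suc (suc (suc (suc j))))))))) _ = m≤m+n 9 j

edited-attractor-size : ∀ m {Γ} → IsAttractor (edited m) Γ → 5 ≤ length Γ
edited-attractor-size m (_ , attracts)
  with i₁ , occ₁ , k₁ , k₁∈Γ , _    , k₁<i₁+3 ← attracts (𝚊 ∷ 𝚋 ∷ 𝚋 ∷ [])     (λ ()) (0 , decide-≤-13+ , refl)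
     | i₂ , occ₂ , k₂ , k₂∈Γ , i₂≤k₂ , k₂<i₂+2 ← attracts (𝚋 ∷ 𝚊 ∷ [])         (λ ()) (3 , decide-≤-13+ , refl)
     | i₃ , occ₃ , k₃ , k₃∈Γ , i₃≤k₃ , k₃<i₃+3 ← attracts (𝚊 ∷ 𝚊 ∷ 𝚋 ∷ [])     (λ ()) (5 , decide-≤-13+ , refl)
     | i₄ , occ₄ , k₄ , k₄∈Γ , i₄≤k₄ , k₄<i₄+1 ← attracts (𝚌 ∷ [])             (λ ()) (8 , decide-≤-13+ , refl)
     | i₅ , occ₅ , k₅ , k₅∈Γ , i₅≤k₅ , _       ← attracts (𝚋 ∷ 𝚋 ∷ 𝚋 ∷ 𝚋 ∷ []) (λ ()) (9 , decide-≤-13+ , refl)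
  with refl ← abb-occurs-only-at-0 m i₁ occ₁
     | refl ← ba-occurs-only-at-3 m i₂ occ₂
     | refl ← aab-occurs-only-at-5 m i₃ occ₃
     | refl ← c-occurs-only-at-8 m i₄ occ₄ =
  Unique-⊆⇒length-≤
    (increasing⇒Unique
      (<-≤-trans k₁<i₁+3 i₂≤k₂ ∷ <-≤-trans k₂<i₂+2 i₃≤k₃ ∷ <-≤-trans k₃<i₃+3 i₄≤k₄ ∷
       <-≤-trans k₄<i₄+1 (≤-trans (bbbb-occurs-only-from-9 m i₅ occ₅) i₅≤k₅) ∷ [-]))
    (All.lookup (k₁∈Γ ∷ k₂∈Γ ∷ k₃∈Γ ∷ k₄∈Γ ∷ k₅∈Γ ∷ []))

γ-source : ∀ k → IsGamma (source k) 2
γ-source k =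
  (4 ∷ 7 ∷ [] , increasing⇒Unique (decide-≤ ∷ [-]) ,
   Covers⇒IsAttractor (decide-≤-13+ ∷ decide-≤-13+ ∷ []) (source-covered k) , refl) ,
  λ Γ _ attr →
    two-letters⇒2≤|attractor| (λ ()) attr (0 , decide-≤-13+ , refl) (1 , decide-≤-13+ , refl)

γ-edited : ∀ m → IsGamma (edited m) 5
γ-edited m =
  (0 ∷ 3 ∷ 5 ∷ 8 ∷ 9 ∷ [] , increasing⇒Unique (decide-≤ ∷ decide-≤ ∷ decide-≤ ∷ decide-≤ ∷ [-]) ,
   Covers⇒IsAttractor (decide-≤-13+ ∷ decide-≤-13+ ∷ decide-≤-13+ ∷ decide-≤-13+ ∷ decide-≤-13+ ∷ [])
     (edited-covered m) , refl) ,
  λ Γ _ attr → edited-attractor-size m attr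

module _ {A : Set} {a b c : A} (a≢b : a ≢ b) (a≢c : a ≢ c) (b≢c : b ≢ c) where

  interpret : Letter → A
  interpret 𝚊 = a
  interpret 𝚋 = b
  interpret 𝚌 = c

  interpret-injective : Injective _≡_ _≡_ interpret
  interpret-injective {𝚊} {𝚊} _  = refl
  interpret-injective {𝚊} {𝚋} eq = ⊥-elim (a≢b eq)
  interpret-injective {𝚊} {𝚌} eq = ⊥-elim (a≢c eq)
  interpret-injective {𝚋} {𝚊} eq = ⊥-elim (a≢b (sym eq))
  interpret-injective {𝚋} {𝚋} _  = refl
  interpret-injective {𝚋} {𝚌} eq = ⊥-elim (b≢c eq)
  interpret-injective {𝚌} {𝚊} eq = ⊥-elim (a≢c (sym eq))
  interpret-injective {𝚌} {𝚋} eq = ⊥-elim (b≢c (sym eq))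
  interpret-injective {𝚌} {𝚌} _  = refl

  source-edit : ∀ op k → ∃[ m ] EdOne op (map interpret (source k)) (map interpret (edited m))
  source-edit ins k = suc k , 8 , decide-≤-13+ , c , refl
  source-edit rep k = k , 8 , decide-≤-13+ , c , (λ c≡b → b≢c (sym c≡b)) , refl

  MS≥5/2 : ∀ op k → MSAtLeast A op (13 + k) 5 2
  MS≥5/2 op k with m , edit ← source-edit op k =
    map interpret (source k) , trans (length-map interpret (source k)) (length-source k) ,
    map interpret (edited m) , edit ,
    2 , 5 , IsGamma-map interpret interpret-injective (γ-source k) ,
    IsGamma-map interpret interpret-injective (γ-edited m) , ≤-refl

mainTheorem3 : (A : Set) (a b c : A) → a ≢ b → a ≢ c → b ≢ c →
    (op : Op) (n : ℕ) → 13 ≤ n → MSAtLeast A op n 5 2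
mainTheorem3 A a b c a≢b a≢c b≢c op n 13≤n =
  subst (λ n → MSAtLeast A op n 5 2) (proj₂ (m≤n⇒∃[o]m+o≡n 13≤n)) (MS≥5/2 a≢b a≢c b≢c op _)
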